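{- Let $G$ be a connected graph and $r\in\mathbb N$, and let $p_r:G_r\to G$ be its $r$-local covering. For every covering $p:C\to G$ that preserves $(r/2)$-balls there is a covering $q:G_r\to C$ such that $p_r=p\circ q$, and any two such coverings $q$ are equivalent (as coverings of $C$).
   Context: Graphs may have loops and parallel edges and are viewed as 1-complexes; coverings have connected covering spaces. For a vertex $x_0$, a closed walk $W$ at $x_0$ stems from a cycle $O$ if $W=W_0QW_0^-$, with $W_0$ a walk from $x_0$ to a vertex of $O$, $Q$ a closed walk traversing each edge of $O$ exactly once, $W_0^-$ the reverse of $W_0$. $\pi_1^r(G,x_0)$ is the (normal) subgroup of $\pi_1(G,x_0)$ generated by closed walks at $x_0$ stemming from cycles of length at most $r$; the $r$-local covering $p_r:G_r\to G$ is the covering with characteristic subgroup $\pi_1^r(G,x_0)$. For a graph $X$, vertex $v$ and $\varrho\in\mathbb N$, the ball $B_X(v,\varrho/2)$ consists of the vertices at distance at most $\varrho/2$ from $v$ and all edges $xy$ with $d_X(v,x)+1+d_X(y,v)\le\varrho$. A covering $p:C\to G$ preserves $(\varrho/2)$-balls if for every vertex $v$ of $G$ and every lift $\hat v$ of $v$, $p$ maps $B_C(\hat v,\varrho/2)$ isomorphically onto $B_G(v,\varrho/2)$. -}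

module Defs where

open import Data.Nat using (ℕ; _+_; _*_; _≤_; suc)
open import Data.Fin using (Fin)
open import Data.List using (List; []; _∷_; _++_; map; length; reverse; lookup)
open import Data.Product using (Σ; _×_; _,_)
open import Relation.Binary.PropositionalEquality using (_≡_; _≢_)
open import Relation.Binary.Construct.Closure.Equivalence using (EqClosure)

-- Graphs as 1-complexes (Serre-style): vertices and darts (= oriented
-- edges).  Every edge {d , rev d} has two distinct orientations, so
-- loops and parallel edges are allowed.

record Graph : Set₁ where
  field
    V         : Set
    D         : Set
    src       : D → V
    rev       : D → D
    rev-invol : ∀ d → rev (rev d) ≡ d
    rev-nofix : ∀ d → rev d ≢ d

  tgt : D → V
  tgt d = src (rev d)

open Graph public

data IsWalk (G : Graph) : V G → V G → List (D G) → Set where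
  nil  : ∀ x → IsWalk G x x []
  cons : ∀ {x y} d ds → src G d ≡ x → IsWalk G (tgt G d) y ds → IsWalk G x y (d ∷ ds)

revW : (G : Graph) → List (D G) → List (D G)
revW G ds = reverse (map (rev G) ds)

Connected : Graph → Set
Connected G = V G × (∀ x y → Σ (List (D G)) λ ds → IsWalk G x y ds)

data Backtrack (G : Graph) : List (D G) → List (D G) → Set where
  cancel : ∀ as d bs → Backtrack G (as ++ d ∷ rev G d ∷ bs) (as ++ bs)

Homotopic : (G : Graph) → List (D G) → List (D G) → Set
Homotopic G = EqClosure (Backtrack G)

record Hom (G H : Graph) : Set where
  field
    fV : V G → V H
    fD : D G → D H
    src-comm : ∀ d → src H (fD d) ≡ fV (src G d)
    rev-comm : ∀ d → fD (rev G d) ≡ rev H (fD d)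

open Hom public

record Iso (G H : Graph) : Set where
  field
    to      : Hom G H
    from    : Hom H G
    fromtoV : ∀ x → fV from (fV to x) ≡ x
    tofromV : ∀ y → fV to (fV from y) ≡ y
    fromtoD : ∀ d → fD from (fD to d) ≡ d
    tofromD : ∀ e → fD to (fD from e) ≡ e

open Iso public

record Covering (C G : Graph) : Set where
  field
    hom       : Hom C G
    connected : Connected C
    surjV     : ∀ x → Σ (V C) λ x̂ → fV hom x̂ ≡ x
    liftD     : ∀ x̂ d → src G d ≡ fV hom x̂ →
                Σ (D C) λ d̂ → (src C d̂ ≡ x̂) × (fD hom d̂ ≡ d)
    injStar   : ∀ d̂ ê → src C d̂ ≡ src C ê → fD hom d̂ ≡ fD hom ê → d̂ ≡ ê

open Covering public

Factors : ∀ {A B G : Graph} → Covering B G → Covering A B → Covering A G → Set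
Factors p q p' =
  (∀ x → fV (hom p) (fV (hom q) x) ≡ fV (hom p') x) ×
  (∀ d → fD (hom p) (fD (hom q) d) ≡ fD (hom p') d)

Equivalent : ∀ {A B : Graph} → Covering A B → Covering A B → Set
Equivalent {A} q q' = Σ (Iso A A) λ φ →
  (∀ x → fV (hom q') (fV (to φ) x) ≡ fV (hom q) x) ×
  (∀ d → fD (hom q') (fD (to φ) d) ≡ fD (hom q) d)

-- characteristic subgroup p_*(π₁(C, x̂)), as a predicate on walks in G

CharSub : ∀ {C G : Graph} → Covering C G → V C → List (D G) → Set
CharSub {C} {G} p x̂ W =
  Σ (List (D C)) λ Ŵ → IsWalk C x̂ x̂ Ŵ × Homotopic G (map (fD (hom p)) Ŵ) W

-- Q is a closed walk at y traversing each edge of a cycle exactly once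
IsCycleWalk : (G : Graph) → V G → List (D G) → Set
IsCycleWalk G y Q =
  IsWalk G y y Q × (1 ≤ length Q) ×
  (∀ (i j : Fin (length Q)) → i ≢ j → src G (lookup Q i) ≢ src G (lookup Q j)) ×
  (∀ (i j : Fin (length Q)) → i ≢ j →
     (lookup Q i ≢ lookup Q j) × (lookup Q i ≢ rev G (lookup Q j)))

-- π₁^r(G, x₀): subgroup generated by closed walks stemming from cycles of
-- length ≤ r (membership of a closed walk at x₀ = of its homotopy class)
data LocalSub (G : Graph) (r : ℕ) (x₀ : V G) : List (D G) → Set where
  gen  : ∀ y W₀ Q → IsWalk G x₀ y W₀ → IsCycleWalk G y Q → length Q ≤ r →
         LocalSub G r x₀ (W₀ ++ Q ++ revW G W₀)
  unit : LocalSub G r x₀ []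
  mul  : ∀ {W₁ W₂} → LocalSub G r x₀ W₁ → LocalSub G r x₀ W₂ → LocalSub G r x₀ (W₁ ++ W₂)
  inv  : ∀ {W} → LocalSub G r x₀ W → LocalSub G r x₀ (revW G W)
  htp  : ∀ {W W'} → LocalSub G r x₀ W → Homotopic G W W' → IsWalk G x₀ x₀ W' →
         LocalSub G r x₀ W'

-- p_r : G_r → G is the r-local covering: its characteristic subgroup
-- (at a base vertex x₀ and lift x̂₀) is π₁^r(G, x₀)
IsLocalCovering : ∀ {Gr G : Graph} → ℕ → Covering Gr G → Set
IsLocalCovering {Gr} {G} r pr =
  Σ (V G) λ x₀ → Σ (V Gr) λ x̂₀ → (fV (hom pr) x̂₀ ≡ x₀) ×
    (∀ W → IsWalk G x₀ x₀ W → (CharSub pr x̂₀ W → LocalSub G r x₀ W) ×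
                               (LocalSub G r x₀ W → CharSub pr x̂₀ W))

DistLe : (X : Graph) → V X → V X → ℕ → Set
DistLe X v x n = Σ (List (D X)) λ ds → IsWalk X v x ds × length ds ≤ n

InBallV : (X : Graph) → V X → ℕ → V X → Set
InBallV X v ρ x = Σ ℕ λ n → DistLe X v x n × 2 * n ≤ ρ

-- the edge of dart d = xy lies in the ball: d(v,x) + 1 + d(y,v) ≤ ρ
InBallD : (X : Graph) → V X → ℕ → D X → Set
InBallD X v ρ d = Σ ℕ λ a → Σ ℕ λ b →
  DistLe X v (src X d) a × DistLe X (tgt X d) v b × a + 1 + b ≤ ρ

-- p maps B_C(v̂, ρ/2) isomorphically onto B_G(v, ρ/2) for all v and lifts v̂
PreservesBalls : ∀ {C G : Graph} → Covering C G → ℕ → Set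
PreservesBalls {C} {G} p ρ = ∀ v v̂ → fV P v̂ ≡ v →
  ((∀ x̂ → InBallV C v̂ ρ x̂ → InBallV G v ρ (fV P x̂)) ×
   (∀ x̂ ŷ → InBallV C v̂ ρ x̂ → InBallV C v̂ ρ ŷ → fV P x̂ ≡ fV P ŷ → x̂ ≡ ŷ) ×
   (∀ x → InBallV G v ρ x → Σ (V C) λ x̂ → InBallV C v̂ ρ x̂ × fV P x̂ ≡ x)) ×
  ((∀ d̂ → InBallD C v̂ ρ d̂ → InBallD G v ρ (fD P d̂)) ×
   (∀ d̂ ê → InBallD C v̂ ρ d̂ → InBallD C v̂ ρ ê → fD P d̂ ≡ fD P ê → d̂ ≡ ê) ×
   (∀ d → InBallD G v ρ d → Σ (D C) λ d̂ → InBallD C v̂ ρ d̂ × fD P d̂ ≡ d))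
  where P = hom p

{-# OPTIONS --safe #-}

-- A map f : A → Z from a connected graph lifts through a covering g : B → Z (with
-- g ∘ f̂ = f) as soon as the f-images of closed walks at a base vertex lift to closed walks;
-- lifting a covering this way yields a covering. For f = p_r and g = p, closed walks of G_r
-- project into π₁^r, generated by conjugates of closed walks of length at most r. Such a
-- short closed walk lifts along p to a closed walk: cut it at its middle dart e; both halves,
-- lifted from the start vertex, stay inside its (r/2)-ball, where p is injective, so they
-- must end at the two ends of the lift of e in that ball. For uniqueness, both factorisations
-- q and q' have π₁^r as characteristic subgroup at every lift of x₀ (π₁^r is normal), so each
-- lifts through the other, and the two lifts are mutually inverse automorphisms of G_r.
-- Homotopy of walks is controlled by free reduction, which is confluent (Newman's lemma).
module Submission where

open import Defs
open import Data.Nat using (ℕ; zero; suc; _+_; _*_; _≤_; _<_; z≤n; s≤s)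
open import Data.Nat.Properties
  using (≤-refl; ≤-trans; ≤-reflexive; ≤-total; +-comm; +-assoc; +-suc; +-identityʳ;
         +-monoʳ-≤; +-monoˡ-≤; suc-injective; <-trans; n≤1+n; n<1+n; m<n⇒m<1+n)
open import Data.Nat.Induction using (<-wellFounded)
open import Data.List using (List; []; _∷_; _++_; map; length; reverse; [_])
open import Data.List.Properties
  using (++-assoc; ++-identityʳ; ++-monoid; length-++; length-map; length-reverse; map-++; map-∘; map-cong;
         reverse-++; reverse-map; unfold-reverse; ∷-injectiveˡ; ∷-injectiveʳ)
open import Data.Product using (Σ; ∃; ∃₂; _×_; _,_; -,_; proj₁; proj₂)
open import Data.Sum using (_⊎_; inj₁; inj₂)
open import Function using (_∘_)
open import Relation.Binary.PropositionalEquality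
  using (_≡_; refl; sym; trans; cong; cong₂; subst; subst₂; module ≡-Reasoning)
open import Relation.Binary.Construct.Closure.ReflexiveTransitive using (Star; ε; _◅_; _◅◅_)
open import Relation.Binary.Construct.Closure.Symmetric using (fwd; bwd)
import Relation.Binary.Construct.Closure.Equivalence as Eq
open import Relation.Binary.Construct.Closure.Equivalence.Properties using (a—↠b⇒a↔b; a—↠b⇒b↔a)
open import Relation.Binary.Construct.Closure.Transitive as Plus using (Plus; _∼⁺⟨_⟩_)
import Relation.Binary.Construct.On as On
import Relation.Binary.Reasoning.Setoid
import Algebra.Solver.Monoid
open import Relation.Binary.Rewriting using (Confluent; WeaklyConfluent; StronglyNormalizing; sn&wcr⇒cr)
open import Induction.WellFounded using (module Subrelation)

m≤n⇒2*m≤m+n : ∀ {m n} → m ≤ n → 2 * m ≤ m + n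
m≤n⇒2*m≤m+n {m} m≤n = +-monoʳ-≤ m (≤-trans (≤-reflexive (+-identityʳ m)) m≤n)

balanced-sum : ∀ m → ∃₂ λ a b → a + b ≡ m × b ≤ a × a ≤ suc b
balanced-sum zero = 0 , 0 , refl , z≤n , z≤n
balanced-sum (suc m) with balanced-sum m
... | a , b , refl , b≤a , a≤1+b = suc b , a , cong suc (+-comm b a) , a≤1+b , s≤s b≤a

module _ {a} {A : Set a} where

  split-at : ∀ m n (xs : List A) → length xs ≡ m + suc n →
             ∃₂ λ as e → ∃ λ bs → xs ≡ as ++ e ∷ bs × length as ≡ m × length bs ≡ n
  split-at zero    n (x ∷ xs) eq = [] , x , xs , refl , refl , suc-injective eq
  split-at (suc m) n (x ∷ xs) eq with split-at m n xs (suc-injective eq)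
  ... | as , e , bs , refl , refl , refl = x ∷ as , e , bs , refl , refl , refl

  middle-split : ∀ x (xs : List A) →
                 ∃₂ λ as e → ∃ λ bs → x ∷ xs ≡ as ++ e ∷ bs ×
                   2 * length as ≤ length as + suc (length bs) ×
                   2 * length bs ≤ length as + suc (length bs)
  middle-split x xs with balanced-sum (length xs)
  ... | a , b , a+b≡n , b≤a , a≤1+b
      with split-at a b (x ∷ xs) (trans (cong suc (sym a+b≡n)) (sym (+-suc a b)))
  ... | as , e , bs , eq , refl , refl =
        as , e , bs , eq , m≤n⇒2*m≤m+n a≤1+b ,
        ≤-trans (m≤n⇒2*m≤m+n b≤a) (≤-trans (≤-reflexive (+-comm b a)) (+-monoʳ-≤ a (n≤1+n b)))

module Walks (X : Graph) where
  open Algebra.Solver.Monoid (++-monoid (D X)) using (solve; _⊕_; _⊜_)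

  IsWalk-++ : ∀ {x y z W W'} → IsWalk X x y W → IsWalk X y z W' → IsWalk X x z (W ++ W')
  IsWalk-++ (nil _)         w' = w'
  IsWalk-++ (cons d _ e w) w' = cons d _ e (IsWalk-++ w w')

  IsWalk-split : ∀ {x z} W {W'} → IsWalk X x z (W ++ W') →
                 ∃ λ y → IsWalk X x y W × IsWalk X y z W'
  IsWalk-split []      w = -, nil _ , w
  IsWalk-split (d ∷ W) (cons .d _ e w) with IsWalk-split W w
  ... | y , w₁ , w₂ = y , cons d W e w₁ , w₂

  IsWalk-end-unique : ∀ {x y y' W} → IsWalk X x y W → IsWalk X x y' W → y ≡ y'
  IsWalk-end-unique (nil _)         (nil _)           = refl
  IsWalk-end-unique (cons _ _ _ w) (cons _ _ _ w') = IsWalk-end-unique w w'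

  IsWalk-dart : ∀ d → IsWalk X (src X d) (tgt X d) [ d ]
  IsWalk-dart d = cons d [] refl (nil _)

  revW-∷ : ∀ d W → revW X (d ∷ W) ≡ revW X W ++ [ rev X d ]
  revW-∷ d W = unfold-reverse (rev X d) (map (rev X) W)

  revW-++ : ∀ W W' → revW X (W ++ W') ≡ revW X W' ++ revW X W
  revW-++ W W' = trans (cong reverse (map-++ (rev X) W W'))
                       (reverse-++ (map (rev X) W) (map (rev X) W'))

  revW-involutive : ∀ W → revW X (revW X W) ≡ W
  revW-involutive []      = refl
  revW-involutive (d ∷ W) = begin
    revW X (revW X (d ∷ W))                ≡⟨ cong (revW X) (revW-∷ d W) ⟩
    revW X (revW X W ++ [ rev X d ])       ≡⟨ revW-++ (revW X W) [ rev X d ] ⟩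
    rev X (rev X d) ∷ revW X (revW X W)    ≡⟨ cong₂ _∷_ (rev-invol X d) (revW-involutive W) ⟩
    d ∷ W                                  ∎
    where open ≡-Reasoning

  length-revW : ∀ W → length (revW X W) ≡ length W
  length-revW W = trans (length-reverse (map (rev X) W)) (length-map (rev X) W)

  IsWalk-revW : ∀ {x y W} → IsWalk X x y W → IsWalk X y x (revW X W)
  IsWalk-revW (nil x) = nil x
  IsWalk-revW (cons d W refl w) = subst (IsWalk X _ _) (sym (revW-∷ d W))
    (IsWalk-++ (IsWalk-revW w)
               (subst (λ z → IsWalk X (tgt X d) (src X z) [ rev X d ]) (rev-invol X d) (IsWalk-dart (rev X d))))

  conj : List (D X) → List (D X) → List (D X)
  conj c W = c ++ W ++ revW X c

  IsWalk-conj : ∀ {x y c W} → IsWalk X x y c → IsWalk X y y W → IsWalk X x x (conj c W)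
  IsWalk-conj wc w = IsWalk-++ wc (IsWalk-++ w (IsWalk-revW wc))

  revW-conj : ∀ c W → revW X (conj c W) ≡ conj c (revW X W)
  revW-conj c W = begin
    revW X (c ++ W ++ revW X c)
      ≡⟨ revW-++ c (W ++ revW X c) ⟩
    revW X (W ++ revW X c) ++ revW X c
      ≡⟨ cong (_++ revW X c) (revW-++ W (revW X c)) ⟩
    (revW X (revW X c) ++ revW X W) ++ revW X c
      ≡⟨ cong (λ U → (U ++ revW X W) ++ revW X c) (revW-involutive c) ⟩
    (c ++ revW X W) ++ revW X c
      ≡⟨ ++-assoc c (revW X W) (revW X c) ⟩
    c ++ revW X W ++ revW X c
      ∎
    where open ≡-Reasoning

  conj-++ : ∀ c c' W → conj (c ++ c') W ≡ conj c (conj c' W)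
  conj-++ c c' W = begin
    (c ++ c') ++ W ++ revW X (c ++ c')            ≡⟨ cong (λ U → (c ++ c') ++ W ++ U) (revW-++ c c') ⟩
    (c ++ c') ++ W ++ revW X c' ++ revW X c
      ≡⟨ solve 5 (λ c c' W r' r → (c ⊕ c') ⊕ W ⊕ r' ⊕ r ⊜ c ⊕ (c' ⊕ W ⊕ r') ⊕ r)
                 refl c c' W (revW X c') (revW X c) ⟩
    c ++ (c' ++ W ++ revW X c') ++ revW X c       ∎
    where open ≡-Reasoning

  DistLe-sym : ∀ {x y n} → DistLe X x y n → DistLe X y x n
  DistLe-sym (W , w , |W|≤n) = revW X W , IsWalk-revW w , subst (_≤ _) (sym (length-revW W)) |W|≤n

  DistLe-extend : ∀ {v n} d → DistLe X v (src X d) n → DistLe X v (tgt X d) (n + 1)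
  DistLe-extend d (W , w , |W|≤n) =
    W ++ [ d ] , IsWalk-++ w (IsWalk-dart d) , subst (_≤ _) (sym (length-++ W)) (+-monoˡ-≤ 1 |W|≤n)

  InBallV-from-distances : ∀ {v ρ x m n} → DistLe X v x m → DistLe X v x n → m + n ≤ ρ →
                           InBallV X v ρ x
  InBallV-from-distances {ρ = ρ} {m = m} {n} dm dn m+n≤ρ with ≤-total m n
  ... | inj₁ m≤n = m , dm , ≤-trans (m≤n⇒2*m≤m+n m≤n) m+n≤ρ
  ... | inj₂ n≤m = n , dn , ≤-trans (m≤n⇒2*m≤m+n n≤m) (subst (_≤ ρ) (+-comm m n) m+n≤ρ)

  InBallD-src : ∀ {v ρ d} → InBallD X v ρ d → InBallV X v ρ (src X d)
  InBallD-src {ρ = ρ} {d} (a , b , da , db , a+1+b≤ρ) =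
    InBallV-from-distances da
      (subst (λ z → DistLe X _ (src X z) (b + 1)) (rev-invol X d) (DistLe-extend (rev X d) (DistLe-sym db)))
      (subst (_≤ ρ) (trans (+-assoc a 1 b) (cong (a +_) (+-comm 1 b))) a+1+b≤ρ)

  InBallD-tgt : ∀ {v ρ d} → InBallD X v ρ d → InBallV X v ρ (tgt X d)
  InBallD-tgt {d = d} (a , b , da , db , a+1+b≤ρ) =
    InBallV-from-distances (DistLe-extend d da) (DistLe-sym db) a+1+b≤ρ

module HomWalks {X Y : Graph} (h : Hom X Y) where

  tgt-comm : ∀ d → tgt Y (fD h d) ≡ fV h (tgt X d)
  tgt-comm d = trans (cong (src Y) (sym (rev-comm h d))) (src-comm h (rev X d))

  IsWalk-map : ∀ {x y W} → IsWalk X x y W → IsWalk Y (fV h x) (fV h y) (map (fD h) W)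
  IsWalk-map (nil x) = nil _
  IsWalk-map (cons d _ refl w) =
    cons (fD h d) _ (src-comm h d) (subst (λ z → IsWalk Y z _ _) (sym (tgt-comm d)) (IsWalk-map w))

  map-revW : ∀ W → map (fD h) (revW X W) ≡ revW Y (map (fD h) W)
  map-revW W = begin
    map (fD h) (reverse (map (rev X) W))     ≡⟨ reverse-map (fD h) (map (rev X) W) ⟩
    reverse (map (fD h) (map (rev X) W))     ≡⟨ cong reverse (sym (map-∘ W)) ⟩
    reverse (map (fD h ∘ rev X) W)           ≡⟨ cong reverse (map-cong (rev-comm h) W) ⟩
    reverse (map (rev Y ∘ fD h) W)           ≡⟨ cong reverse (map-∘ W) ⟩
    reverse (map (rev Y) (map (fD h) W))     ∎
    where open ≡-Reasoning

  map-conj : ∀ c W → map (fD h) (Walks.conj X c W) ≡ Walks.conj Y (map (fD h) c) (map (fD h) W)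
  map-conj c W = begin
    map (fD h) (c ++ W ++ revW X c)
      ≡⟨ map-++ (fD h) c (W ++ revW X c) ⟩
    map (fD h) c ++ map (fD h) (W ++ revW X c)
      ≡⟨ cong (map (fD h) c ++_) (map-++ (fD h) W (revW X c)) ⟩
    map (fD h) c ++ map (fD h) W ++ map (fD h) (revW X c)
      ≡⟨ cong (λ U → map (fD h) c ++ map (fD h) W ++ U) (map-revW c) ⟩
    map (fD h) c ++ map (fD h) W ++ revW Y (map (fD h) c)
      ∎
    where open ≡-Reasoning

module FreeReduction (X : Graph) where
  open Walks X
  open Algebra.Solver.Monoid (++-monoid (D X)) using (solve; _⊕_; _⊜_)

  data Step : List (D X) → List (D X) → Set where
    here  : ∀ d W → Step (d ∷ rev X d ∷ W) W
    there : ∀ d {W W'} → Step W W' → Step (d ∷ W) (d ∷ W')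

  infix 4 _↠_ _∼_

  _↠_ : List (D X) → List (D X) → Set
  _↠_ = Star Step

  _∼_ : List (D X) → List (D X) → Set
  _∼_ = Eq.EqClosure Step

  module ∼-Reasoning = Relation.Binary.Reasoning.Setoid (Eq.setoid Step)

  Step-prefix : ∀ U {W W'} → Step W W' → Step (U ++ W) (U ++ W')
  Step-prefix []      s = s
  Step-prefix (d ∷ U) s = there d (Step-prefix U s)

  Step-suffix : ∀ U {W W'} → Step W W' → Step (W ++ U) (W' ++ U)
  Step-suffix U (here d W)  = here d (W ++ U)
  Step-suffix U (there d s) = there d (Step-suffix U s)

  Backtrack⇒Step : ∀ {W W'} → Backtrack X W W' → Step W W'
  Backtrack⇒Step (cancel U d W) = Step-prefix U (here d W)

  Step⇒Backtrack : ∀ {W W'} → Step W W' → Backtrack X W W'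
  Step⇒Backtrack (here d W) = cancel [] d W
  Step⇒Backtrack (there d s) with Step⇒Backtrack s
  ... | cancel U e W = cancel (d ∷ U) e W

  Homotopic⇒∼ : ∀ {W W'} → Homotopic X W W' → W ∼ W'
  Homotopic⇒∼ = Eq.map Backtrack⇒Step

  ∼⇒Homotopic : ∀ {W W'} → W ∼ W' → Homotopic X W W'
  ∼⇒Homotopic = Eq.map Step⇒Backtrack

  ≡⇒∼ : ∀ {W W'} → W ≡ W' → W ∼ W'
  ≡⇒∼ refl = ε

  ∼-prefix : ∀ U {W W'} → W ∼ W' → U ++ W ∼ U ++ W'
  ∼-prefix U = Eq.gmap (U ++_) (Step-prefix U)

  ∼-suffix : ∀ U {W W'} → W ∼ W' → W ++ U ∼ W' ++ U
  ∼-suffix U = Eq.gmap (_++ U) (Step-suffix U)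

  ∼-infix : ∀ U V {W W'} → W ∼ W' → U ++ W ++ V ∼ U ++ W' ++ V
  ∼-infix U V = ∼-prefix U ∘ ∼-suffix V

  ++-revW-cancel : ∀ W → W ++ revW X W ∼ []
  ++-revW-cancel []      = ε
  ++-revW-cancel (d ∷ W) = begin
    d ∷ W ++ revW X (d ∷ W)                    ≡⟨ cong (λ U → d ∷ W ++ U) (revW-∷ d W) ⟩
    d ∷ W ++ revW X W ++ [ rev X d ]           ≡⟨ cong (d ∷_) (sym (++-assoc W (revW X W) _)) ⟩
    [ d ] ++ (W ++ revW X W) ++ [ rev X d ]    ≈⟨ ∼-infix [ d ] [ rev X d ] (++-revW-cancel W) ⟩
    d ∷ rev X d ∷ []                           ≈⟨ Eq.return (here d []) ⟩
    []                                         ∎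
    where open ∼-Reasoning

  revW-++-cancel : ∀ W → revW X W ++ W ∼ []
  revW-++-cancel W = subst (λ U → revW X W ++ U ∼ []) (revW-involutive W) (++-revW-cancel (revW X W))

  cancel-inner : ∀ U W V → U ++ (revW X W ++ W) ++ V ∼ U ++ V
  cancel-inner U W V = ∼-infix U V (revW-++-cancel W)

  conj-++-conj : ∀ c W₁ W₂ → conj c W₁ ++ conj c W₂ ∼ conj c (W₁ ++ W₂)
  conj-++-conj c W₁ W₂ = begin
    (c ++ W₁ ++ c⁻) ++ c ++ W₂ ++ c⁻
      ≡⟨ solve 4 (λ c W₁ W₂ c⁻ → (c ⊕ W₁ ⊕ c⁻) ⊕ c ⊕ W₂ ⊕ c⁻ ⊜ (c ⊕ W₁) ⊕ (c⁻ ⊕ c) ⊕ W₂ ⊕ c⁻)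
                 refl c W₁ W₂ c⁻ ⟩
    (c ++ W₁) ++ (c⁻ ++ c) ++ W₂ ++ c⁻    ≈⟨ cancel-inner (c ++ W₁) c (W₂ ++ c⁻) ⟩
    (c ++ W₁) ++ W₂ ++ c⁻
      ≡⟨ solve 4 (λ c W₁ W₂ c⁻ → (c ⊕ W₁) ⊕ W₂ ⊕ c⁻ ⊜ c ⊕ (W₁ ⊕ W₂) ⊕ c⁻) refl c W₁ W₂ c⁻ ⟩
    c ++ (W₁ ++ W₂) ++ c⁻                 ∎
    where
      open ∼-Reasoning
      c⁻ : List (D X)
      c⁻ = revW X c

  conj-revW-conj : ∀ c W → conj (revW X c) (conj c W) ∼ W
  conj-revW-conj c W = begin
    c⁻ ++ (c ++ W ++ c⁻) ++ revW X c⁻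
      ≡⟨ cong (λ U → c⁻ ++ (c ++ W ++ c⁻) ++ U) (revW-involutive c) ⟩
    c⁻ ++ (c ++ W ++ c⁻) ++ c
      ≡⟨ solve 3 (λ c W c⁻ → c⁻ ⊕ (c ⊕ W ⊕ c⁻) ⊕ c ⊜ (c⁻ ⊕ c) ⊕ W ⊕ (c⁻ ⊕ c)) refl c W c⁻ ⟩
    (c⁻ ++ c) ++ W ++ (c⁻ ++ c)           ≈⟨ cancel-inner [] c (W ++ c⁻ ++ c) ⟩
    W ++ (c⁻ ++ c)                        ≈⟨ ∼-prefix W (revW-++-cancel c) ⟩
    W ++ []                               ≡⟨ ++-identityʳ W ⟩
    W                                     ∎
    where
      open ∼-Reasoning
      c⁻ : List (D X)
      c⁻ = revW X c

  Step-shortens : ∀ {W W'} → Step W W' → length W' < length W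
  Step-shortens (here d W)  = m<n⇒m<1+n (n<1+n (length W))
  Step-shortens (there d s) = s≤s (Step-shortens s)

  Plus-shortens : ∀ {W W'} → Plus Step W W' → length W' < length W
  Plus-shortens Plus.[ s ]          = Step-shortens s
  Plus-shortens (_ ∼⁺⟨ p ⟩ q) = <-trans (Plus-shortens q) (Plus-shortens p)

  strongly-normalizing : StronglyNormalizing (Plus Step)
  strongly-normalizing = Subrelation.wellFounded Plus-shortens (On.wellFounded length <-wellFounded)

  Step-diamond : ∀ {W U U'} → Step W U → Step W U' → U ≡ U' ⊎ ∃ λ V → Step U V × Step U' V
  Step-diamond (here d W) (here .d .W) = inj₁ refl
  Step-diamond (here d _) (there .d (here .(rev X d) W)) = inj₁ (cong (_∷ W) (rev-invol X d))
  Step-diamond (here d W) (there .d (there .(rev X d) {W' = V} s)) = inj₂ (V , s , here d V)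
  Step-diamond (there .d (here .(rev X d) W)) (here d _) = inj₁ (cong (_∷ W) (sym (rev-invol X d)))
  Step-diamond (there .d (there .(rev X d) {W' = V} s)) (here d W) = inj₂ (V , here d V , s)
  Step-diamond (there d s) (there .d s') with Step-diamond s s'
  ... | inj₁ eq          = inj₁ (cong (d ∷_) eq)
  ... | inj₂ (V , t , t') = inj₂ (d ∷ V , there d t , there d t')

  weakly-confluent : WeaklyConfluent Step
  weakly-confluent s s' with Step-diamond s s'
  ... | inj₁ refl         = -, ε , ε
  ... | inj₂ (V , t , t') = V , t ◅ ε , t' ◅ ε

  confluent : Confluent Step
  confluent = sn&wcr⇒cr strongly-normalizing weakly-confluent

  church-rosser : ∀ {W W'} → W ∼ W' → ∃ λ V → W ↠ V × W' ↠ V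
  church-rosser ε = -, ε , ε
  church-rosser (fwd s ◅ h) with church-rosser h
  ... | V , r , r' = V , s ◅ r , r'
  church-rosser (bwd s ◅ h) with church-rosser h
  ... | V , r , r' with confluent r (s ◅ ε)
  ...   | V' , t , t' = V' , t' , r' ◅◅ t

module CoveringLifts {B Z : Graph} (g : Covering B Z) where
  open Walks B
  open HomWalks (hom g)
  module FB = FreeReduction B
  module FZ = FreeReduction Z

  project : D B → D Z
  project = fD (hom g)

  Lifts : V B → List (D Z) → V B → Set
  Lifts b W b' = ∃ λ Ŵ → IsWalk B b b' Ŵ × map project Ŵ ≡ W

  lift : ∀ {z y W} b → fV (hom g) b ≡ z → IsWalk Z z y W → ∃ λ b' → Lifts b W b' × fV (hom g) b' ≡ y
  lift b refl (nil _) = b , ([] , nil b , refl) , refl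
  lift b refl (cons d W e w) with liftD g b d e
  ... | d̂ , refl , refl with lift (tgt B d̂) (sym (tgt-comm d̂)) w
  ...   | b' , (Ŵ , ŵ , refl) , b'↦y = b' , (d̂ ∷ Ŵ , cons d̂ Ŵ refl ŵ , refl) , b'↦y

  lifted-walk-unique : ∀ {b b₁ b₂ Ŵ₁ Ŵ₂} → IsWalk B b b₁ Ŵ₁ → IsWalk B b b₂ Ŵ₂ →
                       map project Ŵ₁ ≡ map project Ŵ₂ → Ŵ₁ ≡ Ŵ₂
  lifted-walk-unique (nil _)         (nil _)           _  = refl
  lifted-walk-unique (cons d _ e w) (cons d' _ e' w') eq
    with injStar g d d' (trans e (sym e')) (∷-injectiveˡ eq)
  ... | refl = cong (d ∷_) (lifted-walk-unique w w' (∷-injectiveʳ eq))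

  Lifts-end-unique : ∀ {b W b₁ b₂} → Lifts b W b₁ → Lifts b W b₂ → b₁ ≡ b₂
  Lifts-end-unique (Ŵ₁ , w₁ , refl) (Ŵ₂ , w₂ , eq) with lifted-walk-unique w₁ w₂ (sym eq)
  ... | refl = IsWalk-end-unique w₁ w₂

  Lifts-++ : ∀ {a b c W W'} → Lifts a W b → Lifts b W' c → Lifts a (W ++ W') c
  Lifts-++ (Ŵ , w , refl) (Ŵ' , w' , refl) = Ŵ ++ Ŵ' , IsWalk-++ w w' , map-++ project Ŵ Ŵ'

  Lifts-split : ∀ {a c} W {W'} → Lifts a (W ++ W') c → ∃ λ b → Lifts a W b × Lifts b W' c
  Lifts-split []      l = -, ([] , nil _ , refl) , l
  Lifts-split (d ∷ W) (d̂ ∷ Ŵ , cons .d̂ .Ŵ e w , eq) with Lifts-split W (Ŵ , w , ∷-injectiveʳ eq)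
  ... | b , (Ŵ₁ , w₁ , refl) , l₂ = b , (d̂ ∷ Ŵ₁ , cons d̂ Ŵ₁ e w₁ , cong (_∷ _) (∷-injectiveˡ eq)) , l₂

  Lifts-revW : ∀ {a b W} → Lifts a W b → Lifts b (revW Z W) a
  Lifts-revW (Ŵ , w , refl) = revW B Ŵ , IsWalk-revW w , map-revW Ŵ

  Lifts-revW⁻¹ : ∀ {a b W} → Lifts a (revW Z W) b → Lifts b W a
  Lifts-revW⁻¹ {W = W} l = subst (λ U → Lifts _ U _) (Walks.revW-involutive Z W) (Lifts-revW l)

  Lifts-dart : ∀ d̂ → Lifts (src B d̂) [ project d̂ ] (tgt B d̂)
  Lifts-dart d̂ = [ d̂ ] , IsWalk-dart d̂ , refl

  Lifts⇒DistLe : ∀ {b W b'} → Lifts b W b' → DistLe B b b' (length W)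
  Lifts⇒DistLe (Ŵ , w , refl) = Ŵ , w , ≤-reflexive (sym (length-map project Ŵ))

  Step-lift : ∀ {b b' Ŵ W W'} → IsWalk B b b' Ŵ → map project Ŵ ≡ W → FZ.Step W W' →
              ∃ λ Ŵ' → FB.Step Ŵ Ŵ' × IsWalk B b b' Ŵ' × map project Ŵ' ≡ W'
  Step-lift (nil _)                        ()  (FZ.here _ _)
  Step-lift (cons _ _ _ (nil _))           ()  (FZ.here _ _)
  Step-lift (cons d̂ _ refl (cons ê Ŵ e w)) eq (FZ.here d W) =
    Ŵ , backtrack , subst (λ x → IsWalk B x _ Ŵ) ê-tgt w , ∷-injectiveʳ (∷-injectiveʳ eq)
    where
      ê≡d̂⁻ : ê ≡ rev B d̂
      ê≡d̂⁻ = injStar g ê (rev B d̂) e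
        (trans (∷-injectiveˡ (∷-injectiveʳ eq))
          (trans (cong (rev Z) (sym (∷-injectiveˡ eq))) (sym (rev-comm (hom g) d̂))))
      backtrack : FB.Step (d̂ ∷ ê ∷ Ŵ) Ŵ
      backtrack = subst (λ x → FB.Step (d̂ ∷ x ∷ Ŵ) Ŵ) (sym ê≡d̂⁻) (FB.here d̂ Ŵ)
      ê-tgt : tgt B ê ≡ src B d̂
      ê-tgt = trans (cong (tgt B) ê≡d̂⁻) (cong (src B) (rev-invol B d̂))
  Step-lift (nil _)          () (FZ.there _ _)
  Step-lift (cons d̂ Ŵ e w) eq (FZ.there _ s) with Step-lift w (∷-injectiveʳ eq) s
  ... | Ŵ' , ŝ , w' , refl = d̂ ∷ Ŵ' , FB.there d̂ ŝ , cons d̂ Ŵ' e w' , cong (_∷ _) (∷-injectiveˡ eq)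

  ↠-lift : ∀ {b b' Ŵ W'} → IsWalk B b b' Ŵ → map project Ŵ FZ.↠ W' →
           ∃ λ Ŵ' → Ŵ FB.↠ Ŵ' × IsWalk B b b' Ŵ' × map project Ŵ' ≡ W'
  ↠-lift {Ŵ = Ŵ} w ε = Ŵ , ε , w , refl
  ↠-lift w (s ◅ r) with Step-lift w refl s
  ... | Ŵ₁ , ŝ , w₁ , refl with ↠-lift w₁ r
  ...   | Ŵ₂ , r̂ , w₂ , eq = Ŵ₂ , ŝ ◅ r̂ , w₂ , eq

  -- Both projections reduce to a common walk; the reductions lift, and the lift of the
  -- common walk from b is unique.
  homotopy-lifting : ∀ {b b₁ b₂ Ŵ₁ Ŵ₂} → IsWalk B b b₁ Ŵ₁ → IsWalk B b b₂ Ŵ₂ →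
                     map project Ŵ₁ FZ.∼ map project Ŵ₂ → b₁ ≡ b₂ × Ŵ₁ FB.∼ Ŵ₂
  homotopy-lifting w₁ w₂ h with FZ.church-rosser h
  ... | V , r₁ , r₂ with ↠-lift w₁ r₁ | ↠-lift w₂ r₂
  ... | U₁ , r̂₁ , u₁ , eq₁ | U₂ , r̂₂ , u₂ , eq₂ with lifted-walk-unique u₁ u₂ (trans eq₁ (sym eq₂))
  ... | refl = IsWalk-end-unique u₁ u₂ , a—↠b⇒a↔b r̂₁ ◅◅ a—↠b⇒b↔a r̂₂

  Lifts-∼ : ∀ {b W W' b₁ b₂} → Lifts b W b₁ → Lifts b W' b₂ → W FZ.∼ W' → b₁ ≡ b₂
  Lifts-∼ (_ , w₁ , refl) (_ , w₂ , refl) h = proj₁ (homotopy-lifting w₁ w₂ h)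

module LiftingCriterion {A B Z : Graph} (f : Hom A Z) (g : Covering B Z) (connA : Connected A)
  (a₀ : V A) (b₀ : V B) (b₀↦ : fV (hom g) b₀ ≡ fV f a₀)
  (closed-lifts : ∀ Ŵ → IsWalk A a₀ a₀ Ŵ → CoveringLifts.Lifts g b₀ (map (fD f) Ŵ) b₀) where

  open CoveringLifts g
  open Walks A
  open HomWalks f

  path : ∀ a → ∃ λ W → IsWalk A a₀ a W
  path a = proj₂ connA a₀ a

  lift-of-path : ∀ a → ∃ λ b → Lifts b₀ (map (fD f) (proj₁ (path a))) b × fV (hom g) b ≡ fV f a
  lift-of-path a = lift b₀ b₀↦ (IsWalk-map (proj₂ (path a)))

  f̂V : V A → V B
  f̂V a = proj₁ (lift-of-path a)

  f̂V-commutes : ∀ a → fV (hom g) (f̂V a) ≡ fV f a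
  f̂V-commutes a = proj₂ (proj₂ (lift-of-path a))

  there-and-back-lifts : ∀ {a W} → IsWalk A a₀ a W →
                         Lifts b₀ (map (fD f) W ++ revW Z (map (fD f) (proj₁ (path a)))) b₀
  there-and-back-lifts {a} {W} w = subst (λ U → Lifts b₀ U b₀) map-there-and-back
      (closed-lifts (W ++ revW A γ) (IsWalk-++ w (IsWalk-revW (proj₂ (path a)))))
    where
      γ : List (D A)
      γ = proj₁ (path a)
      map-there-and-back : map (fD f) (W ++ revW A γ) ≡ map (fD f) W ++ revW Z (map (fD f) γ)
      map-there-and-back = trans (map-++ (fD f) W (revW A γ)) (cong (map (fD f) W ++_) (map-revW γ))

  f̂V-unique : ∀ {a W b} → IsWalk A a₀ a W → Lifts b₀ (map (fD f) W) b → b ≡ f̂V a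
  f̂V-unique {a} {W} w l with Lifts-split (map (fD f) W) (there-and-back-lifts w)
  ... | c , l₁ , l₂ =
    trans (Lifts-end-unique l l₁) (Lifts-end-unique (Lifts-revW⁻¹ l₂) (proj₁ (proj₂ (lift-of-path a))))

  dart-lift : ∀ d → ∃ λ d̂ → src B d̂ ≡ f̂V (src A d) × fD (hom g) d̂ ≡ fD f d
  dart-lift d = liftD g (f̂V (src A d)) (fD f d) (trans (src-comm f d) (sym (f̂V-commutes (src A d))))

  f̂D : D A → D B
  f̂D d = proj₁ (dart-lift d)

  f̂D-src : ∀ d → src B (f̂D d) ≡ f̂V (src A d)
  f̂D-src d = proj₁ (proj₂ (dart-lift d))

  f̂D-commutes : ∀ d → fD (hom g) (f̂D d) ≡ fD f d
  f̂D-commutes d = proj₂ (proj₂ (dart-lift d))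

  f̂D-tgt : ∀ d → tgt B (f̂D d) ≡ f̂V (tgt A d)
  f̂D-tgt d = f̂V-unique (IsWalk-++ (proj₂ (path a)) (IsWalk-dart d)) lift-through-d
    where
      a : V A
      a = src A d
      lift-through-d : Lifts b₀ (map (fD f) (proj₁ (path a) ++ [ d ])) (tgt B (f̂D d))
      lift-through-d = subst (λ U → Lifts b₀ U (tgt B (f̂D d))) (sym (map-++ (fD f) (proj₁ (path a)) [ d ]))
                             (Lifts-++ lift-to-src lift-d)
        where
          lift-to-src : Lifts b₀ (map (fD f) (proj₁ (path a))) (src B (f̂D d))
          lift-to-src = subst (Lifts b₀ _) (sym (f̂D-src d)) (proj₁ (proj₂ (lift-of-path a)))
          lift-d : Lifts (src B (f̂D d)) [ fD f d ] (tgt B (f̂D d))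
          lift-d = subst (λ e → Lifts (src B (f̂D d)) [ e ] (tgt B (f̂D d))) (f̂D-commutes d)
                         (Lifts-dart (f̂D d))

  f̂ : Hom A B
  f̂ = record
    { fV = f̂V ; fD = f̂D ; src-comm = f̂D-src
    ; rev-comm = λ d → injStar g (f̂D (rev A d)) (rev B (f̂D d))
        (trans (f̂D-src (rev A d)) (sym (f̂D-tgt d)))
        (trans (f̂D-commutes (rev A d)) (trans (rev-comm f d)
          (trans (cong (rev Z) (sym (f̂D-commutes d))) (sym (rev-comm (hom g) (f̂D d))))))
    }


module CoveringLiftingCriterion {A B Z : Graph} (fc : Covering A Z) (g : Covering B Z) (connB : Connected B)
  (a₀ : V A) (b₀ : V B) (b₀↦ : fV (hom g) b₀ ≡ fV (hom fc) a₀)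
  (closed-lifts : ∀ Ŵ → IsWalk A a₀ a₀ Ŵ → CoveringLifts.Lifts g b₀ (map (fD (hom fc)) Ŵ) b₀) where

  open LiftingCriterion (hom fc) g (connected fc) a₀ b₀ b₀↦ closed-lifts public

  f̂-covering : Covering A B
  f̂-covering = record
    { hom       = f̂
    ; connected = connected fc
    ; surjV     = surjective
    ; liftD     = dart-lifts
    ; injStar   = λ d d' same-src same-image → injStar fc d d' same-src
        (trans (sym (f̂D-commutes d)) (trans (cong (fD (hom g)) same-image) (f̂D-commutes d')))
    }
    where
      surjective : ∀ c → ∃ λ a → f̂V a ≡ c
      surjective c with proj₂ connB b₀ c
      ... | W , w with CoveringLifts.lift fc a₀ (sym b₀↦) (HomWalks.IsWalk-map (hom g) w)
      ...   | a , (Ŵ , ŵ , eq) , _ = a , sym (f̂V-unique ŵ (W , w , sym eq))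
      dart-lifts : ∀ a c → src B c ≡ f̂V a → ∃ λ d → src A d ≡ a × f̂D d ≡ c
      dart-lifts a c c-src with liftD fc a (fD (hom g) c)
                                  (trans (src-comm (hom g) c) (trans (cong (fV (hom g)) c-src) (f̂V-commutes a)))
      ... | d , refl , d↦ = d , refl ,
            injStar g (f̂D d) c (trans (f̂D-src d) (sym c-src)) (trans (f̂D-commutes d) d↦)

coverings-equivalent : ∀ {A B : Graph} (q q' : Covering A B) (a₀ a₁ : V A) →
  fV (hom q') a₁ ≡ fV (hom q) a₀ →
  (∀ Ŵ → IsWalk A a₀ a₀ Ŵ → CoveringLifts.Lifts q' a₁ (map (fD (hom q)) Ŵ) a₁) →
  (∀ Ŵ → IsWalk A a₁ a₁ Ŵ → CoveringLifts.Lifts q a₀ (map (fD (hom q')) Ŵ) a₀) →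
  Equivalent q q'
coverings-equivalent {A} q q' a₀ a₁ a₁↦ q-lifts q'-lifts = iso , Φ.f̂V-commutes , Φ.f̂D-commutes
  where
    module Φ = LiftingCriterion (hom q) q' (connected q) a₀ a₁ a₁↦ q-lifts
    module Ψ = LiftingCriterion (hom q') q (connected q) a₁ a₀ (sym a₁↦) q'-lifts

    ΨΦ-id : ∀ a → Ψ.f̂V (Φ.f̂V a) ≡ a
    ΨΦ-id a with Φ.lift-of-path a
    ... | _ , (Ŵ , ŵ , eq) , _ = sym (Ψ.f̂V-unique ŵ (_ , proj₂ (Φ.path a) , sym eq))

    ΦΨ-id : ∀ a → Φ.f̂V (Ψ.f̂V a) ≡ a
    ΦΨ-id a with Ψ.lift-of-path a
    ... | _ , (Ŵ , ŵ , eq) , _ = sym (Φ.f̂V-unique ŵ (_ , proj₂ (Ψ.path a) , sym eq))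

    iso : Iso A A
    iso = record
      { to = Φ.f̂ ; from = Ψ.f̂ ; fromtoV = ΨΦ-id ; tofromV = ΦΨ-id
      ; fromtoD = λ d → injStar q (Ψ.f̂D (Φ.f̂D d)) d
          (trans (Ψ.f̂D-src (Φ.f̂D d)) (trans (cong Ψ.f̂V (Φ.f̂D-src d)) (ΨΦ-id (src A d))))
          (trans (Ψ.f̂D-commutes (Φ.f̂D d)) (Φ.f̂D-commutes d))
      ; tofromD = λ d → injStar q' (Φ.f̂D (Ψ.f̂D d)) d
          (trans (Φ.f̂D-src (Ψ.f̂D d)) (trans (cong Φ.f̂V (Ψ.f̂D-src d)) (ΦΨ-id (src A d))))
          (trans (Φ.f̂D-commutes (Ψ.f̂D d)) (Ψ.f̂D-commutes d))
      }

module LocalSubgroup (X : Graph) (r : ℕ) (x₀ : V X) where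
  open Walks X
  open FreeReduction X

  LocalSub-IsWalk : ∀ {W} → LocalSub X r x₀ W → IsWalk X x₀ x₀ W
  LocalSub-IsWalk (gen _ _ _ w₀ cyc _) = IsWalk-++ w₀ (IsWalk-++ (proj₁ cyc) (IsWalk-revW w₀))
  LocalSub-IsWalk unit                 = nil x₀
  LocalSub-IsWalk (mul s s')           = IsWalk-++ (LocalSub-IsWalk s) (LocalSub-IsWalk s')
  LocalSub-IsWalk (inv s)              = IsWalk-revW (LocalSub-IsWalk s)
  LocalSub-IsWalk (htp _ _ w)          = w

  LocalSub-conj : ∀ {W c} → LocalSub X r x₀ W → IsWalk X x₀ x₀ c → LocalSub X r x₀ (conj c W)
  LocalSub-conj {c = c} (gen y W₀ Q w₀ cyc len) wc =
    subst (LocalSub X r x₀) (conj-++ c W₀ Q) (gen y (c ++ W₀) Q (IsWalk-++ wc w₀) cyc len)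
  LocalSub-conj {c = c} unit wc =
    htp unit (∼⇒Homotopic (Eq.symmetric Step (++-revW-cancel c))) (IsWalk-conj wc (nil x₀))
  LocalSub-conj {c = c} (mul {W₁} {W₂} s s') wc =
    htp (mul (LocalSub-conj s wc) (LocalSub-conj s' wc)) (∼⇒Homotopic (conj-++-conj c W₁ W₂))
        (IsWalk-conj wc (LocalSub-IsWalk (mul s s')))
  LocalSub-conj {c = c} (inv {W} s) wc =
    subst (LocalSub X r x₀) (revW-conj c W) (inv (LocalSub-conj s wc))
  LocalSub-conj {c = c} (htp s h w) wc =
    htp (LocalSub-conj s wc) (∼⇒Homotopic (∼-infix c (revW X c) (Homotopic⇒∼ h))) (IsWalk-conj wc w)

module CharacteristicSubgroup {A X : Graph} (π : Covering A X) where
  open CoveringLifts π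
  open Walks X
  open FreeReduction X

  CharSub-∼ : ∀ {â W W'} → CharSub π â W → W ∼ W' → CharSub π â W'
  CharSub-∼ (Ŵ , ŵ , h) h' = Ŵ , ŵ , ∼⇒Homotopic (Homotopic⇒∼ h ◅◅ h')

  CharSub-conj : ∀ {â b̂ γ W} → Lifts â γ b̂ → CharSub π b̂ W → CharSub π â (conj γ W)
  CharSub-conj {γ = γ} (γ̂ , wγ , refl) (Ŵ , ŵ , h) =
    Walks.conj A γ̂ Ŵ , Walks.IsWalk-conj A wγ ŵ ,
    ∼⇒Homotopic (≡⇒∼ (HomWalks.map-conj (hom π) γ̂ Ŵ) ◅◅ ∼-infix γ (revW X γ) (Homotopic⇒∼ h))

module BallPreserving {C G : Graph} (p : Covering C G) (r : ℕ) (pb : PreservesBalls p r) where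
  open CoveringLifts p
  open HomWalks (hom p)
  open Walks C

  ball-injectiveV : ∀ {v v̂} → fV (hom p) v̂ ≡ v → ∀ x̂ ŷ → InBallV C v̂ r x̂ → InBallV C v̂ r ŷ →
                    fV (hom p) x̂ ≡ fV (hom p) ŷ → x̂ ≡ ŷ
  ball-injectiveV v̂↦v = proj₁ (proj₂ (proj₁ (pb _ _ v̂↦v)))

  ball-surjectiveD : ∀ {v v̂} → fV (hom p) v̂ ≡ v → ∀ d → InBallD G v r d →
                     ∃ λ d̂ → InBallD C v̂ r d̂ × fD (hom p) d̂ ≡ d
  ball-surjectiveD v̂↦v = proj₂ (proj₂ (proj₂ (pb _ _ v̂↦v)))

  -- The lifts of as and of bs⁻ from ŷ end in the ball around ŷ, at the two ends of the
  -- lift of e in that ball, by injectivity of p on the ball.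
  split-closed-walk-lifts : ∀ {y ŷ as e bs} → fV (hom p) ŷ ≡ y → IsWalk G y y (as ++ e ∷ bs) →
                            2 * length as ≤ r → 2 * length bs ≤ r → length as + 1 + length bs ≤ r →
                            Lifts ŷ (as ++ e ∷ bs) ŷ
  split-closed-walk-lifts {ŷ = ŷ} {as} {e} {bs} ŷ↦y w 2a≤r 2b≤r a+1+b≤r
    with Walks.IsWalk-split G as w
  ... | _ , w-as , cons .e .bs refl w-bs
    with lift ŷ ŷ↦y w-as | lift ŷ ŷ↦y (Walks.IsWalk-revW G w-bs)
       | ball-surjectiveD ŷ↦y e (length as , length bs , (as , w-as , ≤-refl) , (bs , w-bs , ≤-refl) , a+1+b≤r)
  ... | m̂ , l-as , m̂↦ | n̂ , l-bs , n̂↦ | ê , ê-in-ball , refl =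
    Lifts-++ (subst (Lifts ŷ as) m̂≡src l-as)
             (Lifts-++ (Lifts-dart ê) (Lifts-revW⁻¹ (subst (Lifts ŷ (revW G bs)) n̂≡tgt l-bs)))
    where
      m̂≡src : m̂ ≡ src C ê
      m̂≡src = ball-injectiveV ŷ↦y m̂ (src C ê) (length as , Lifts⇒DistLe l-as , 2a≤r)
                (InBallD-src ê-in-ball) (trans m̂↦ (src-comm (hom p) ê))
      n̂≡tgt : n̂ ≡ tgt C ê
      n̂≡tgt = ball-injectiveV ŷ↦y n̂ (tgt C ê)
                (length bs , subst (DistLe C ŷ n̂) (Walks.length-revW G bs) (Lifts⇒DistLe l-bs) , 2b≤r)
                (InBallD-tgt ê-in-ball) (trans n̂↦ (tgt-comm ê))

  short-closed-walk-lifts : ∀ {y ŷ Q} → fV (hom p) ŷ ≡ y → IsWalk G y y Q → length Q ≤ r → Lifts ŷ Q ŷ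
  short-closed-walk-lifts {ŷ = ŷ} _ (nil _) _ = [] , nil ŷ , refl
  short-closed-walk-lifts {ŷ = ŷ} ŷ↦y w@(cons d Q _ _) |Q|≤r with middle-split d Q
  ... | as , e , bs , Q≡ , 2a≤ , 2b≤ = subst (λ U → Lifts ŷ U ŷ) (sym Q≡)
    (split-closed-walk-lifts ŷ↦y (subst (IsWalk G _ _) Q≡ w) (≤-trans 2a≤ |Q|≤r') (≤-trans 2b≤ |Q|≤r')
      (subst (_≤ r) (sym (+-assoc (length as) 1 (length bs))) |Q|≤r'))
    where
      |Q|≤r' : length as + suc (length bs) ≤ r
      |Q|≤r' = subst (_≤ r) (trans (cong length Q≡) (length-++ as)) |Q|≤r

  LocalSub-lifts : ∀ {x₀ W ĉ} → LocalSub G r x₀ W → fV (hom p) ĉ ≡ x₀ → Lifts ĉ W ĉ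
  LocalSub-lifts (gen y W₀ Q w₀ cyc |Q|≤r) ĉ↦ with lift _ ĉ↦ w₀
  ... | ŷ , l₀ , ŷ↦y =
    Lifts-++ l₀ (Lifts-++ (short-closed-walk-lifts ŷ↦y (proj₁ cyc) |Q|≤r) (Lifts-revW l₀))
  LocalSub-lifts unit       _  = [] , nil _ , refl
  LocalSub-lifts (mul s s') ĉ↦ = Lifts-++ (LocalSub-lifts s ĉ↦) (LocalSub-lifts s' ĉ↦)
  LocalSub-lifts (inv s)    ĉ↦ = Lifts-revW (LocalSub-lifts s ĉ↦)
  LocalSub-lifts (htp {W' = W'} s h w) ĉ↦ with lift _ ĉ↦ w
  ... | ĉ' , l , _ =
    subst (Lifts _ W') (sym (Lifts-∼ (LocalSub-lifts s ĉ↦) l (FreeReduction.Homotopic⇒∼ G h))) l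

module LocalCovering {G Gr : Graph} (r : ℕ) (pr : Covering Gr G) (x₀ : V G) (x̂₀ : V Gr)
  (x̂₀↦ : fV (hom pr) x̂₀ ≡ x₀)
  (local : ∀ W → IsWalk G x₀ x₀ W →
             (CharSub pr x̂₀ W → LocalSub G r x₀ W) × (LocalSub G r x₀ W → CharSub pr x̂₀ W))
  where

  open CoveringLifts pr
  open CharacteristicSubgroup pr
  open LocalSubgroup G r x₀
  open Walks G
  open FreeReduction G

  IsWalk-project : ∀ {x̂ x̂' Ŵ} → fV (hom pr) x̂ ≡ x₀ → fV (hom pr) x̂' ≡ x₀ →
                   IsWalk Gr x̂ x̂' Ŵ → IsWalk G x₀ x₀ (map project Ŵ)
  IsWalk-project x̂↦ x̂'↦ ŵ = subst₂ (λ x x' → IsWalk G x x' _) x̂↦ x̂'↦ (HomWalks.IsWalk-map (hom pr) ŵ)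

  -- Conjugating by the projection γ of a path from x̂₀ to x̂ identifies the characteristic
  -- subgroups at x̂ and at x̂₀, and leaves the normal subgroup π₁^r invariant.
  CharSub⇔LocalSub : ∀ {x̂} → fV (hom pr) x̂ ≡ x₀ → ∀ {W} → IsWalk G x₀ x₀ W →
                     (CharSub pr x̂ W → LocalSub G r x₀ W) × (LocalSub G r x₀ W → CharSub pr x̂ W)
  CharSub⇔LocalSub {x̂} x̂↦ {W} w = into , onto
    where
      γ̂ : List (D Gr)
      γ̂ = proj₁ (proj₂ (connected pr) x̂₀ x̂)
      ŵγ : IsWalk Gr x̂₀ x̂ γ̂
      ŵγ = proj₂ (proj₂ (connected pr) x̂₀ x̂)
      γ : List (D G)
      γ = map project γ̂
      lγ : Lifts x̂₀ γ x̂
      lγ = γ̂ , ŵγ , refl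
      wγ : IsWalk G x₀ x₀ γ
      wγ = IsWalk-project x̂₀↦ x̂↦ ŵγ
      wγWγ⁻ : IsWalk G x₀ x₀ (conj γ W)
      wγWγ⁻ = IsWalk-conj wγ w
      into : CharSub pr x̂ W → LocalSub G r x₀ W
      into cs = htp (LocalSub-conj (proj₁ (local _ wγWγ⁻) (CharSub-conj lγ cs)) (IsWalk-revW wγ))
                  (∼⇒Homotopic (conj-revW-conj γ W)) w
      onto : LocalSub G r x₀ W → CharSub pr x̂ W
      onto ls = CharSub-∼ (CharSub-conj (Lifts-revW lγ) (proj₂ (local _ wγWγ⁻) (LocalSub-conj ls wγ)))
                          (conj-revW-conj γ W)

  closed-walk-local : ∀ {x̂ Ŵ} → fV (hom pr) x̂ ≡ x₀ → IsWalk Gr x̂ x̂ Ŵ →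
                      LocalSub G r x₀ (map project Ŵ)
  closed-walk-local {Ŵ = Ŵ} x̂↦ ŵ = proj₁ (CharSub⇔LocalSub x̂↦ (IsWalk-project x̂↦ x̂↦ ŵ)) (Ŵ , ŵ , ε)

  -- π₁^r is the characteristic subgroup at x̂ and at x̂', so Ŵ is homotopic over G to a closed
  -- walk Ŵ' at x̂'. Lifting that homotopy along p gives q' Ŵ' ∼ q Ŵ in C, so the q'-lift of
  -- q Ŵ from x̂' ends where Ŵ' does.
  factorisations-lift-closed-walks : ∀ {C} (p : Covering C G) (q q' : Covering Gr C) →
    Factors p q pr → Factors p q' pr →
    ∀ {x̂ x̂'} → fV (hom pr) x̂ ≡ x₀ → fV (hom pr) x̂' ≡ x₀ → fV (hom q') x̂' ≡ fV (hom q) x̂ →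
    ∀ Ŵ → IsWalk Gr x̂ x̂ Ŵ → CoveringLifts.Lifts q' x̂' (map (fD (hom q)) Ŵ) x̂'
  factorisations-lift-closed-walks {C} p q q' (_ , pq≡) (_ , pq'≡) {x̂} {x̂'} x̂↦ x̂'↦ x̂'↑ Ŵ ŵ
    with closed-walk-local x̂↦ ŵ
  ... | ls with proj₂ (CharSub⇔LocalSub x̂'↦ (LocalSub-IsWalk ls)) ls
  ... | Ŵ' , ŵ' , h with CoveringLifts.lift q' x̂' x̂'↑ (HomWalks.IsWalk-map (hom q) ŵ)
  ... | z , l , _ = subst (CoveringLifts.Lifts q' x̂' (map (fD (hom q)) Ŵ)) (sym x̂'≡z) l
    where
      over : ∀ {f : Covering Gr C} → (∀ d → fD (hom p) (fD (hom f) d) ≡ project d) → ∀ Ŵ →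
             map (fD (hom p)) (map (fD (hom f)) Ŵ) ≡ map project Ŵ
      over pf≡ Ŵ = trans (sym (map-∘ Ŵ)) (map-cong pf≡ Ŵ)
      w' : IsWalk C (fV (hom q) x̂) (fV (hom q) x̂) (map (fD (hom q')) Ŵ')
      w' = subst (λ c → IsWalk C c c _) x̂'↑ (HomWalks.IsWalk-map (hom q') ŵ')
      q'Ŵ'∼qŴ : FreeReduction._∼_ C (map (fD (hom q')) Ŵ') (map (fD (hom q)) Ŵ)
      q'Ŵ'∼qŴ = proj₂ (CoveringLifts.homotopy-lifting p w' (HomWalks.IsWalk-map (hom q) ŵ)
                  (≡⇒∼ (over {q'} pq'≡ Ŵ') ◅◅ Homotopic⇒∼ h ◅◅ ≡⇒∼ (sym (over {q} pq≡ Ŵ))))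
      x̂'≡z : x̂' ≡ z
      x̂'≡z = CoveringLifts.Lifts-∼ q' (Ŵ' , ŵ' , refl) l q'Ŵ'∼qŴ

lemma4p4 : (G : Graph) → Connected G → (r : ℕ) →
    (Gr : Graph) (pr : Covering Gr G) → IsLocalCovering r pr →
    (C : Graph) (p : Covering C G) → PreservesBalls p r →
    (Σ (Covering Gr C) λ q → Factors p q pr) ×
    (∀ (q q' : Covering Gr C) → Factors p q pr → Factors p q' pr → Equivalent q q')
lemma4p4 G _ r Gr pr (x₀ , x̂₀ , x̂₀↦ , local) C p pb = existence , uniqueness
  where
    open LocalCovering r pr x₀ x̂₀ x̂₀↦ local

    ĉ₀ : V C
    ĉ₀ = proj₁ (surjV p x₀)

    ĉ₀↦ : fV (hom p) ĉ₀ ≡ x₀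
    ĉ₀↦ = proj₂ (surjV p x₀)

    existence : Σ (Covering Gr C) λ q → Factors p q pr
    existence = f̂-covering , f̂V-commutes , f̂D-commutes
      where
        open CoveringLiftingCriterion pr p (connected p) x̂₀ ĉ₀ (trans ĉ₀↦ (sym x̂₀↦))
               (λ _ ŵ → BallPreserving.LocalSub-lifts p r pb (closed-walk-local x̂₀↦ ŵ) ĉ₀↦)

    uniqueness : ∀ (q q' : Covering Gr C) → Factors p q pr → Factors p q' pr → Equivalent q q'
    uniqueness q q' pq≡ pq'≡ =
      coverings-equivalent q q' x̂₀ x̂₁ x̂₁↑
        (factorisations-lift-closed-walks p q q' pq≡ pq'≡ x̂₀↦ x̂₁↦ x̂₁↑)
        (factorisations-lift-closed-walks p q' q pq'≡ pq≡ x̂₁↦ x̂₀↦ (sym x̂₁↑))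
      where
        x̂₁ : V Gr
        x̂₁ = proj₁ (surjV q' (fV (hom q) x̂₀))
        x̂₁↑ : fV (hom q') x̂₁ ≡ fV (hom q) x̂₀
        x̂₁↑ = proj₂ (surjV q' (fV (hom q) x̂₀))
        x̂₁↦ : fV (hom pr) x̂₁ ≡ x₀
        x̂₁↦ = trans (sym (proj₁ pq'≡ x̂₁)) (trans (cong (fV (hom p)) x̂₁↑) (trans (proj₁ pq≡ x̂₀) x̂₀↦))
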